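{- Let $a,b,p,q\in\mathbb{Z}$, let $(h_n)$ be defined by $h_0=a$, $h_1=b$, $h_n=ph_{n-1}+qh_{n-2}$ for $n\ge 2$, let $n\ge 1$ and $\mathbf{h}=(h_0,\dots,h_{n-1})$. If $h_i\ge 0$ for all $i=0,\dots,n-1$, then $$\|\mathbf{C}(\mathbf{h})\|=h_0+\dots+h_{n-1},$$ where: if $p+q\ne 1$, then $h_0+\dots+h_{n-1}=\dfrac{h_n+qh_{n-1}+(p-1)a-b}{p+q-1}$; if $p+q=1$ and $p\ne 2$, then $h_0+\dots+h_{n-1}=\dfrac{qh_{n-1}+(n-1)(qa+b)+a}{q+1}$; if $p=2$ and $q=-1$, then $h_0+\dots+h_{n-1}=n\,\dfrac{h_{n-1}+a}{2}$.
   Context: For $\mathbf{x}=(x_0,\dots,x_{n-1})\in\mathbb{R}^n$, the circulant matrix $\mathbf{C}(\mathbf{x})$ is the $n\times n$ matrix whose first row is $(x_0,x_1,\dots,x_{n-1})$ and each subsequent row is the cyclic right shift of the previous one; i.e. its $(r,c)$ entry ($r,c=1,\dots,n$) is $x_{(c-r) \bmod n}$. $\|\cdot\|$ denotes the spectral norm.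
   Formalization: The spectral norm ‖C(h)‖ is taken as a supremum over test vectors in ℚ^n with rational thresholds, rather than over ℝ^n. -}

module Defs where

open import Data.Nat as ℕ using (ℕ; zero; suc; _∸_)
open import Data.Nat.DivMod using (_mod_)
open import Data.Fin as F using (Fin; toℕ)
open import Data.Integer as ℤ using (ℤ)
open import Data.Rational as ℚ using (ℚ; 0ℚ; _/_)
open import Data.Product using (Σ; _×_)

hseq : ℤ → ℤ → ℤ → ℤ → ℕ → ℤ
hseq a b p q zero = a
hseq a b p q (suc zero) = b
hseq a b p q (suc (suc n)) = p ℤ.* hseq a b p q (suc n) ℤ.+ q ℤ.* hseq a b p q n

partialSum : (ℕ → ℤ) → ℕ → ℤ
partialSum f zero = ℤ.+ 0
partialSum f (suc n) = partialSum f n ℤ.+ f n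

toℚ : ℤ → ℚ
toℚ z = z / 1

sumFin : (n : ℕ) → (Fin n → ℚ) → ℚ
sumFin zero f = 0ℚ
sumFin (suc n) f = f F.zero ℚ.+ sumFin n (λ i → f (F.suc i))


-- Circulant matrix C(x): entry (r,c) is x_{(c - r) mod n}.
circulant : (n : ℕ) → (Fin n → ℚ) → Fin n → Fin n → ℚ
circulant zero x r c = x r
circulant (suc m) x r c = x ((toℕ c ℕ.+ (suc m ∸ toℕ r)) mod suc m)

mulVec : (n : ℕ) → (Fin n → Fin n → ℚ) → (Fin n → ℚ) → Fin n → ℚ
mulVec n M v r = sumFin n (λ c → M r c ℚ.* v c)

sqNorm : (n : ℕ) → (Fin n → ℚ) → ℚ
sqNorm n v = sumFin n (λ i → v i ℚ.* v i)

-- s is the spectral (ℓ²-operator) norm of M, i.e. s = sup_{x ≠ 0} ‖Mx‖/‖x‖: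
-- s ≥ 0, s is an upper bound, and every smaller nonnegative t is exceeded.
-- (Vectors range over ℚⁿ.)
IsSpectralNorm : (n : ℕ) → (Fin n → Fin n → ℚ) → ℚ → Set
IsSpectralNorm n M s =
  (0ℚ ℚ.≤ s)
  × ((x : Fin n → ℚ) → sqNorm n (mulVec n M x) ℚ.≤ (s ℚ.* s) ℚ.* sqNorm n x)
  × ((t : ℚ) → 0ℚ ℚ.≤ t → t ℚ.< s →
       Σ (Fin n → ℚ) (λ x → (t ℚ.* t) ℚ.* sqNorm n x ℚ.< sqNorm n (mulVec n M x)))

{-# OPTIONS --safe #-}
-- The circulant matrix of a nonnegative vector x is a nonnegative matrix all of whose rows and
-- columns sum to S = x₀ + … + x_{n-1}.  For such a matrix Cauchy–Schwarz in each row (the Schur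
-- test) gives ‖Mx‖ ≤ S‖x‖, and the all-ones vector is mapped to S times itself, so ‖M‖ = S.
-- The closed forms for S follow by induction from the recurrence: when p + q = 1 the quantity
-- h_{k+1} + q h_k is invariant, and when (p, q) = (2, -1) the sequence is arithmetic.
module Submission where

open import Defs
open import Data.Nat as ℕ using (ℕ; zero; suc; _∸_)
open import Data.Fin using (toℕ)
open import Data.Fin.Properties using (toℕ<n)
open import Data.Integer as ℤ using (ℤ; +_; -[1+_])
open import Data.Product using (_×_; _,_)
open import Relation.Binary.PropositionalEquality

module SchurTest where

  open import Algebra.Bundles using (CommutativeRing)
  open import Data.Fin using (Fin; zero; suc)
  open import Data.Rational using (ℚ; 0ℚ; 1ℚ; _+_; _*_; _-_; -_; _≤_; _<_; nonNegative; nonPositive; positive)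
  open import Data.Rational.Properties
    using (≤-refl; ≤-total; <⇒≤; ≤-<-trans; <-≤-trans; positive⁻¹; +-mono-≤; +-monoʳ-≤; +-monoˡ-≤;
           +-identityʳ; +-inverseʳ; *-assoc; *-zeroʳ; *-identityʳ; *-monoˡ-≤-nonNeg; *-monoˡ-≤-nonPos;
           *-monoˡ-<-pos; +-*-commutativeRing; module ≤-Reasoning)
  open import Data.Rational.Solver using (module +-*-Solver)
  open import Data.Sum using (inj₁; inj₂)
  open import Data.Vec.Functional using (Vector)
  open import Algebra.Properties.Semiring.Sum (CommutativeRing.semiring +-*-commutativeRing)
    using (sum; sum-cong-≗; ∑-distrib-+; ∑-comm; *-distribˡ-sum; *-distribʳ-sum)

  square-nonNeg : ∀ x → 0ℚ ≤ x * x
  square-nonNeg x with ≤-total 0ℚ x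
  ... | inj₁ 0≤x = subst (_≤ x * x) (*-zeroʳ x) (*-monoˡ-≤-nonNeg x {{nonNegative 0≤x}} 0≤x)
  ... | inj₂ x≤0 = subst (_≤ x * x) (*-zeroʳ x) (*-monoˡ-≤-nonPos x {{nonPositive x≤0}} x≤0)

  *-nonNeg : ∀ {p q} → 0ℚ ≤ p → 0ℚ ≤ q → 0ℚ ≤ p * q
  *-nonNeg {p} 0≤p 0≤q = subst (_≤ p * _) (*-zeroʳ p) (*-monoˡ-≤-nonNeg p {{nonNegative 0≤p}} 0≤q)

  p≤p+q : ∀ {p q} → 0ℚ ≤ q → p ≤ p + q
  p≤p+q {p} 0≤q = subst (_≤ p + _) (+-identityʳ p) (+-monoʳ-≤ p 0≤q)

  p≤q⇒0≤q-p : ∀ {p q} → p ≤ q → 0ℚ ≤ q - p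
  p≤q⇒0≤q-p {p} {q} p≤q = subst (_≤ q - p) (+-inverseʳ p) (+-monoˡ-≤ (- p) p≤q)

  square-mono-< : ∀ {p q} → 0ℚ ≤ p → p < q → p * p < q * q
  square-mono-< {p} {q} 0≤p p<q = ≤-<-trans
    (*-monoˡ-≤-nonNeg p {{nonNegative 0≤p}} (<⇒≤ p<q))
    (*-monoˡ-<-pos q {{positive (≤-<-trans 0≤p p<q)}} p<q)

  sum-mono-≤ : ∀ {n} {f g : Vector ℚ n} → (∀ i → f i ≤ g i) → sum f ≤ sum g
  sum-mono-≤ {zero} f≤g = ≤-refl
  sum-mono-≤ {suc n} f≤g = +-mono-≤ (f≤g zero) (sum-mono-≤ (λ i → f≤g (suc i)))

  sum-nonNeg : ∀ {n} {f : Vector ℚ n} → (∀ i → 0ℚ ≤ f i) → 0ℚ ≤ sum f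
  sum-nonNeg {zero} _ = ≤-refl
  sum-nonNeg {suc n} 0≤f = +-mono-≤ (0≤f zero) (sum-nonNeg (λ i → 0≤f (suc i)))

  sumFin≡sum : ∀ n (f : Vector ℚ n) → sumFin n f ≡ sum f
  sumFin≡sum zero f = refl
  sumFin≡sum (suc n) f = cong (λ s → f zero + s) (sumFin≡sum n (λ i → f (suc i)))

  weighted-sum-square-sub : ∀ {n} (w x : Vector ℚ n) y →
    sum (λ i → w i * ((x i - y) * (x i - y)))
      ≡ sum (λ i → w i * (x i * x i)) + (- (y + y)) * sum (λ i → w i * x i) + (y * y) * sum w
  weighted-sum-square-sub w x y = begin
    sum (λ i → w i * ((x i - y) * (x i - y)))
      ≡⟨ sum-cong-≗ (λ i → expand (w i) (x i) y) ⟩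
    sum (λ i → (wx² i + c * wx i) + (y * y) * w i)
      ≡⟨ ∑-distrib-+ (λ i → wx² i + c * wx i) (λ i → (y * y) * w i) ⟩
    sum (λ i → wx² i + c * wx i) + sum (λ i → (y * y) * w i)
      ≡⟨ cong₂ _+_ (∑-distrib-+ wx² (λ i → c * wx i)) (sym (*-distribˡ-sum (y * y) w)) ⟩
    sum wx² + sum (λ i → c * wx i) + (y * y) * sum w
      ≡⟨ cong (λ s → sum wx² + s + (y * y) * sum w) (*-distribˡ-sum c wx) ⟨
    sum wx² + c * sum wx + (y * y) * sum w ∎
    where
    open ≡-Reasoning
    open +-*-Solver
    c = - (y + y)
    wx = λ i → w i * x i
    wx² = λ i → w i * (x i * x i)
    expand : ∀ w x y → w * ((x - y) * (x - y)) ≡ (w * (x * x) + (- (y + y)) * (w * x)) + (y * y) * w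
    expand = solve 3 (λ w x y → w :* ((x :- y) :* (x :- y))
                              := (w :* (x :* x) :+ (:- (y :+ y)) :* (w :* x)) :+ (y :* y) :* w) refl

  -- Adding a term (w₀, x₀) raises (Σ w)(Σ w x²) − (Σ w x)² by w₀ Σ wᵢ (xᵢ − x₀)² ≥ 0.
  weighted-cauchy-schwarz : ∀ {n} (w x : Vector ℚ n) → (∀ i → 0ℚ ≤ w i) →
    sum (λ i → w i * x i) * sum (λ i → w i * x i) ≤ sum w * sum (λ i → w i * (x i * x i))
  weighted-cauchy-schwarz {zero} w x w≥0 = ≤-refl
  weighted-cauchy-schwarz {suc n} w x w≥0 = begin
    (w₀ * x₀ + A) * (w₀ * x₀ + A)
      ≤⟨ p≤p+q (+-mono-≤ (p≤q⇒0≤q-p A²≤WB) (*-nonNeg (w≥0 zero) D≥0)) ⟩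
    (w₀ * x₀ + A) * (w₀ * x₀ + A) + ((W * B - A * A) + w₀ * D)
      ≡⟨ regroup w₀ x₀ A W B ⟩
    (w₀ + W) * (w₀ * (x₀ * x₀) + B) ∎
    where
    open ≤-Reasoning
    open +-*-Solver
    w₀ = w zero
    x₀ = x zero
    w′ = λ i → w (suc i)
    x′ = λ i → x (suc i)
    A = sum (λ i → w′ i * x′ i)
    W = sum w′
    B = sum (λ i → w′ i * (x′ i * x′ i))
    D = B + (- (x₀ + x₀)) * A + (x₀ * x₀) * W
    A²≤WB : A * A ≤ W * B
    A²≤WB = weighted-cauchy-schwarz w′ x′ (λ i → w≥0 (suc i))
    D≥0 : 0ℚ ≤ D
    D≥0 = subst (0ℚ ≤_) (weighted-sum-square-sub w′ x′ x₀)
            (sum-nonNeg (λ i → *-nonNeg (w≥0 (suc i)) (square-nonNeg (x′ i - x₀))))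
    regroup : ∀ w₀ x₀ A W B →
      (w₀ * x₀ + A) * (w₀ * x₀ + A) + ((W * B - A * A) + w₀ * (B + (- (x₀ + x₀)) * A + (x₀ * x₀) * W))
        ≡ (w₀ + W) * (w₀ * (x₀ * x₀) + B)
    regroup = solve 5 (λ w₀ x₀ A W B →
      (w₀ :* x₀ :+ A) :* (w₀ :* x₀ :+ A)
        :+ ((W :* B :- A :* A) :+ w₀ :* (B :+ (:- (x₀ :+ x₀)) :* A :+ (x₀ :* x₀) :* W))
        := (w₀ :+ W) :* (w₀ :* (x₀ :* x₀) :+ B)) refl

  schur-test : ∀ {n} (M : Fin n → Fin n → ℚ) {R C} → (∀ r c → 0ℚ ≤ M r c) →
    (∀ r → sum (M r) ≡ R) → (∀ c → sum (λ r → M r c) ≡ C) →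
    ∀ x → sqNorm n (mulVec n M x) ≤ (R * C) * sqNorm n x
  schur-test {n} M {R} {C} M≥0 rows cols x = begin
    sqNorm n (mulVec n M x)
      ≡⟨ trans (sumFin≡sum n (λ r → Mx r * Mx r)) (sum-cong-≗ (λ r → cong₂ _*_ (Mx≡ r) (Mx≡ r))) ⟩
    sum (λ r → sum (λ c → M r c * x c) * sum (λ c → M r c * x c))
      ≤⟨ sum-mono-≤ (λ r → weighted-cauchy-schwarz (M r) x (M≥0 r)) ⟩
    sum (λ r → sum (M r) * sum (λ c → M r c * x² c))
      ≡⟨ sum-cong-≗ (λ r → cong (_* sum (λ c → M r c * x² c)) (rows r)) ⟩
    sum (λ r → R * sum (λ c → M r c * x² c))
      ≡⟨ *-distribˡ-sum R (λ r → sum (λ c → M r c * x² c)) ⟨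
    R * sum (λ r → sum (λ c → M r c * x² c))
      ≡⟨ cong (R *_) (∑-comm (λ r c → M r c * x² c)) ⟩
    R * sum (λ c → sum (λ r → M r c * x² c))
      ≡⟨ cong (R *_) (sum-cong-≗ column) ⟩
    R * sum (λ c → C * x² c)
      ≡⟨ cong (R *_) (*-distribˡ-sum C x²) ⟨
    R * (C * sum x²)
      ≡⟨ *-assoc R C (sum x²) ⟨
    (R * C) * sum x²
      ≡⟨ cong ((R * C) *_) (sumFin≡sum n x²) ⟨
    (R * C) * sqNorm n x ∎
    where
    open ≤-Reasoning
    Mx = mulVec n M x
    Mx≡ : ∀ r → Mx r ≡ sum (λ c → M r c * x c)
    Mx≡ r = sumFin≡sum n (λ c → M r c * x c)
    x² : Vector ℚ n
    x² c = x c * x c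
    column : ∀ c → sum (λ r → M r c * x² c) ≡ C * x² c
    column c = trans (sym (*-distribʳ-sum (x² c) (λ r → M r c))) (cong (_* x² c) (cols c))

  𝟙 : ∀ n → Vector ℚ n
  𝟙 n _ = 1ℚ

  sqNorm-mulVec-𝟙 : ∀ {n} (M : Fin n → Fin n → ℚ) {R} → (∀ r → sum (M r) ≡ R) →
    sqNorm n (mulVec n M (𝟙 n)) ≡ (R * R) * sqNorm n (𝟙 n)
  sqNorm-mulVec-𝟙 {n} M {R} rows = begin
    sqNorm n (mulVec n M (𝟙 n))        ≡⟨ sumFin≡sum n (λ r → M𝟙 r * M𝟙 r) ⟩
    sum (λ r → M𝟙 r * M𝟙 r)             ≡⟨ sum-cong-≗ {n} (λ r → trans (cong₂ _*_ (M𝟙≡R r) (M𝟙≡R r))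
                                                                      (sym (*-identityʳ (R * R)))) ⟩
    sum {n} (λ _ → (R * R) * 1ℚ)        ≡⟨ *-distribˡ-sum {n} (R * R) (λ _ → 1ℚ) ⟨
    (R * R) * sum {n} (λ _ → 1ℚ)        ≡⟨ cong ((R * R) *_) (sumFin≡sum n (λ _ → 1ℚ)) ⟨
    (R * R) * sqNorm n (𝟙 n)            ∎
    where
    open ≡-Reasoning
    M𝟙 = mulVec n M (𝟙 n)
    M𝟙≡R : ∀ r → M𝟙 r ≡ R
    M𝟙≡R r = trans (sumFin≡sum n (λ c → M r c * 1ℚ))
                   (trans (sum-cong-≗ (λ c → *-identityʳ (M r c))) (rows r))

  sqNorm-𝟙-pos : ∀ m → 0ℚ < sqNorm (suc m) (𝟙 (suc m))
  sqNorm-𝟙-pos m = <-≤-trans (positive⁻¹ 1ℚ) (p≤p+q (subst (0ℚ ≤_) (sym (sumFin≡sum m (λ _ → 1ℚ)))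
                                                          (sum-nonNeg {m} (λ _ → <⇒≤ (positive⁻¹ 1ℚ)))))

  isSpectralNorm-of-line-sums : ∀ {m} (M : Fin (suc m) → Fin (suc m) → ℚ) {S} → (∀ r c → 0ℚ ≤ M r c) →
    (∀ r → sum (M r) ≡ S) → (∀ c → sum (λ r → M r c) ≡ S) → IsSpectralNorm (suc m) M S
  isSpectralNorm-of-line-sums {m} M {S} M≥0 rows cols =
    S≥0 , schur-test M M≥0 rows cols , λ t 0≤t t<S → 𝟙 n , 𝟙-exceeds 0≤t t<S
    where
    n = suc m
    S≥0 : 0ℚ ≤ S
    S≥0 = subst (0ℚ ≤_) (rows zero) (sum-nonNeg (M≥0 zero))
    𝟙-exceeds : ∀ {t} → 0ℚ ≤ t → t < S → (t * t) * sqNorm n (𝟙 n) < sqNorm n (mulVec n M (𝟙 n))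
    𝟙-exceeds {t} 0≤t t<S = begin-strict
      (t * t) * sqNorm n (𝟙 n)     <⟨ *-monoˡ-<-pos (sqNorm n (𝟙 n)) {{positive (sqNorm-𝟙-pos m)}}
                                                    (square-mono-< 0≤t t<S) ⟩
      (S * S) * sqNorm n (𝟙 n)     ≡⟨ sqNorm-mulVec-𝟙 M rows ⟨
      sqNorm n (mulVec n M (𝟙 n))  ∎
      where open ≤-Reasoning

module Circulant where

  open import Algebra.Bundles using (CommutativeRing)
  open import Data.Fin using (Fin; toℕ; opposite)
  open import Data.Fin.Properties using (toℕ-fromℕ<; toℕ<n; toℕ-injective; opposite-prop)
  open import Data.Fin.Permutation using (permutation; reverse)
  open import Data.Nat using (_+_; _%_; s≤s⁻¹)
  open import Data.Nat.DivMod using (_mod_; m%n<n; %-distribˡ-+; m%n%n≡m%n; [m+n]%n≡m%n; m<n⇒m%n≡m)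
  open import Data.Nat.Properties using (+-assoc; +-comm; +-suc; +-∸-assoc; m∸n+n≡m; m+[n∸m]≡n; <⇒≤)
  open import Data.Rational using (ℚ; 0ℚ; _≤_)
  open import Data.Rational.Properties using (+-*-commutativeRing)
  open import Algebra.Properties.Semiring.Sum (CommutativeRing.semiring +-*-commutativeRing)
    using (sum; sum-cong-≗; sum-permute)
  open import Data.Vec.Functional using (Vector)
  open SchurTest using (isSpectralNorm-of-line-sums)
  open ≡-Reasoning

  [m%n+k]%n≡[m+k]%n : ∀ m k n .{{_ : ℕ.NonZero n}} → (m % n + k) % n ≡ (m + k) % n
  [m%n+k]%n≡[m+k]%n m k n = begin
    (m % n + k) % n            ≡⟨ %-distribˡ-+ (m % n) k n ⟩
    (m % n % n + k % n) % n    ≡⟨ cong (λ r → (r + k % n) % n) (m%n%n≡m%n m n) ⟩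
    (m % n + k % n) % n        ≡⟨ %-distribˡ-+ m k n ⟨
    (m + k) % n                ∎

  module _ (m : ℕ) where
    private
      N = suc m

    rotate : ℕ → Fin N → Fin N
    rotate k i = (toℕ i + k) mod N

    rotate-inverse : ∀ {j k} → j + k ≡ N → ∀ i → rotate k (rotate j i) ≡ i
    rotate-inverse {j} {k} j+k≡N i = toℕ-injective (begin
      toℕ (rotate k (rotate j i))    ≡⟨ toℕ-fromℕ< (m%n<n (toℕ (rotate j i) + k) N) ⟩
      (toℕ (rotate j i) + k) % N     ≡⟨ cong (λ r → (r + k) % N) (toℕ-fromℕ< (m%n<n (toℕ i + j) N)) ⟩
      ((toℕ i + j) % N + k) % N      ≡⟨ [m%n+k]%n≡[m+k]%n (toℕ i + j) k N ⟩
      (toℕ i + j + k) % N            ≡⟨ cong (_% N) (trans (+-assoc (toℕ i) j k) (cong (λ l → toℕ i + l) j+k≡N)) ⟩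
      (toℕ i + N) % N                ≡⟨ [m+n]%n≡m%n (toℕ i) N ⟩
      toℕ i % N                      ≡⟨ m<n⇒m%n≡m (toℕ<n i) ⟩
      toℕ i                          ∎)

    sum-rotate : ∀ {j k} → j + k ≡ N → (g : Vector ℚ N) → sum (λ i → g (rotate j i)) ≡ sum g
    sum-rotate {j} {k} j+k≡N g = sym (sum-permute g
      (permutation (rotate j) (rotate k) (rotate-inverse (trans (+-comm k j) j+k≡N)) (rotate-inverse j+k≡N)))

    sum-circulant-row : ∀ (x : Vector ℚ N) r → sum (circulant N x r) ≡ sum x
    sum-circulant-row x r = sum-rotate (m∸n+n≡m (<⇒≤ (toℕ<n r))) x

    -- Down a column the index (c - r) mod n runs backwards: in reversed row order it is a rotation.
    sum-circulant-column : ∀ (x : Vector ℚ N) c → sum (λ r → circulant N x r c) ≡ sum x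
    sum-circulant-column x c = begin
      sum (λ r → circulant N x r c)  ≡⟨ sum-cong-≗ (λ r → cong (λ k → x (k mod N)) (reflect r)) ⟩
      sum (λ r → y (opposite r))     ≡⟨ sum-permute y reverse ⟨
      sum y                          ≡⟨ sum-rotate (m+[n∸m]≡n (toℕ<n c)) x ⟩
      sum x                          ∎
      where
      y : Vector ℚ N
      y = λ r → x (rotate (suc (toℕ c)) r)
      reflect : ∀ r → toℕ c + (N ∸ toℕ r) ≡ toℕ (opposite r) + suc (toℕ c)
      reflect r = begin
        toℕ c + (N ∸ toℕ r)            ≡⟨ cong (λ d → toℕ c + d) (+-∸-assoc 1 (s≤s⁻¹ (toℕ<n r))) ⟩
        toℕ c + suc (m ∸ toℕ r)        ≡⟨ +-suc (toℕ c) (m ∸ toℕ r) ⟩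
        suc (toℕ c + (m ∸ toℕ r))      ≡⟨ cong suc (+-comm (toℕ c) (m ∸ toℕ r)) ⟩
        suc (m ∸ toℕ r + toℕ c)        ≡⟨ +-suc (m ∸ toℕ r) (toℕ c) ⟨
        m ∸ toℕ r + suc (toℕ c)        ≡⟨ cong (_+ suc (toℕ c)) (opposite-prop r) ⟨
        toℕ (opposite r) + suc (toℕ c) ∎

    isSpectralNorm-circulant : ∀ (x : Vector ℚ N) → (∀ i → 0ℚ ≤ x i) →
      IsSpectralNorm N (circulant N x) (sum x)
    isSpectralNorm-circulant x x≥0 = isSpectralNorm-of-line-sums (circulant N x) (λ r c → x≥0 _)
      (sum-circulant-row x) (sum-circulant-column x)

module IntegerToRational where

  open import Data.Fin using (Fin; toℕ; inject₁; fromℕ)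
  open import Data.Fin.Properties using (toℕ-inject₁; toℕ-fromℕ)
  open import Data.Integer.Properties using (*-identityʳ)
  open import Data.Nat.Coprimality using (1-coprimeTo) renaming (sym to coprime-sym)
  open import Data.Rational using (ℚ; mkℚ; _+_; _≤_; *≤*)
  open import Data.Rational.Properties using (↥p/↧p≡p; +-*-commutativeRing)
  open import Algebra.Bundles using (CommutativeRing)
  open import Algebra.Properties.Semiring.Sum (CommutativeRing.semiring +-*-commutativeRing)
    using (sum; sum-cong-≗; sum-init-last)
  open ≡-Reasoning

  -- toℚ z = z / 1 goes through normalisation; fromℤ z is the same number with numerator literally z,
  -- on which _+_ and _≤_ compute.
  private
    fromℤ : ℤ → ℚ
    fromℤ z = mkℚ z 0 (coprime-sym (1-coprimeTo _))

    toℚ≡fromℤ : ∀ z → toℚ z ≡ fromℤ z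
    toℚ≡fromℤ z = ↥p/↧p≡p (fromℤ z)

  toℚ-+ : ∀ x y → toℚ (x ℤ.+ y) ≡ toℚ x + toℚ y
  toℚ-+ x y = begin
    toℚ (x ℤ.+ y)                       ≡⟨ cong toℚ (cong₂ ℤ._+_ (*-identityʳ x) (*-identityʳ y)) ⟨
    toℚ (x ℤ.* + 1 ℤ.+ y ℤ.* + 1)       ≡⟨⟩
    fromℤ x + fromℤ y                   ≡⟨ cong₂ _+_ (toℚ≡fromℤ x) (toℚ≡fromℤ y) ⟨
    toℚ x + toℚ y                       ∎

  toℚ-mono-≤ : ∀ {x y} → x ℤ.≤ y → toℚ x ≤ toℚ y
  toℚ-mono-≤ {x} {y} x≤y = subst₂ _≤_ (sym (toℚ≡fromℤ x)) (sym (toℚ≡fromℤ y))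
    (*≤* (subst₂ ℤ._≤_ (sym (*-identityʳ x)) (sym (*-identityʳ y)) x≤y))

  toℚ-partialSum : ∀ (f : ℕ → ℤ) n → toℚ (partialSum f n) ≡ sum (λ (i : Fin n) → toℚ (f (toℕ i)))
  toℚ-partialSum f zero = refl
  toℚ-partialSum f (suc n) = begin
    toℚ (partialSum f n ℤ.+ f n)             ≡⟨ toℚ-+ (partialSum f n) (f n) ⟩
    toℚ (partialSum f n) + toℚ (f n)         ≡⟨ cong₂ _+_ (trans (toℚ-partialSum f n) (sum-cong-≗ front)) last ⟩
    sum (λ i → g (inject₁ i)) + g (fromℕ n)  ≡⟨ sum-init-last g ⟨
    sum g                                    ∎
    where
    g : Fin (suc n) → ℚ
    g i = toℚ (f (toℕ i))
    front : ∀ i → toℚ (f (toℕ i)) ≡ g (inject₁ i)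
    front i = cong (λ j → toℚ (f j)) (sym (toℕ-inject₁ i))
    last : toℚ (f n) ≡ g (fromℕ n)
    last = cong (λ j → toℚ (f j)) (sym (toℕ-fromℕ n))

module RecurrenceSums where

  open import Data.Integer using (_+_; _*_; _-_)
  open import Data.Integer.Properties using (*-distribˡ-+; *-identityˡ)
  open import Data.Integer.Tactic.RingSolver using (solve)
  open import Data.List.Base using (_∷_; [])
  open ≡-Reasoning

  module _ (a b p q : ℤ) where
    private
      h = hseq a b p q
      S = partialSum h

    partialSum-hseq : ∀ k → (p + q - + 1) * S (suc k) ≡ h (suc k) + q * h k + (p - + 1) * a - b
    partialSum-hseq zero = begin
      (p + q - + 1) * (+ 0 + a)      ≡⟨ solve (a ∷ b ∷ p ∷ q ∷ []) ⟩
      b + q * a + (p - + 1) * a - b  ∎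
    partialSum-hseq (suc k) = begin
      (p + q - + 1) * (S (suc k) + h (suc k))
        ≡⟨ *-distribˡ-+ (p + q - + 1) (S (suc k)) (h (suc k)) ⟩
      (p + q - + 1) * S (suc k) + (p + q - + 1) * h (suc k)
        ≡⟨ cong (_+ (p + q - + 1) * h (suc k)) (partialSum-hseq k) ⟩
      h (suc k) + q * h k + (p - + 1) * a - b + (p + q - + 1) * h (suc k)
        ≡⟨ regroup (h (suc k)) (h k) ⟩
      (p * h (suc k) + q * h k) + q * h (suc k) + (p - + 1) * a - b ∎
      where
      regroup : ∀ x y → x + q * y + (p - + 1) * a - b + (p + q - + 1) * x
                      ≡ (p * x + q * y) + q * x + (p - + 1) * a - b
      regroup x y = solve (x ∷ y ∷ a ∷ b ∷ p ∷ q ∷ [])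

    module _ (p+q≡1 : p + q ≡ + 1) where

      hseq-invariant : ∀ k → h (suc k) + q * h k ≡ b + q * a
      hseq-invariant zero = refl
      hseq-invariant (suc k) = begin
        (p * h (suc k) + q * h k) + q * h (suc k)  ≡⟨ regroup (h (suc k)) (h k) ⟩
        (p + q) * h (suc k) + q * h k              ≡⟨ cong (λ s → s * h (suc k) + q * h k) p+q≡1 ⟩
        + 1 * h (suc k) + q * h k                  ≡⟨ cong (_+ q * h k) (*-identityˡ (h (suc k))) ⟩
        h (suc k) + q * h k                        ≡⟨ hseq-invariant k ⟩
        b + q * a                                  ∎
        where
        regroup : ∀ x y → (p * x + q * y) + q * x ≡ (p + q) * x + q * y
        regroup x y = solve (x ∷ y ∷ p ∷ q ∷ [])

      -- The solver treats + k as an atom; + 1 + + k reduces to + suc k.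
      partialSum-hseq-p+q≡1 : ∀ k → (q + + 1) * S (suc k) ≡ q * h k + + k * (q * a + b) + a
      partialSum-hseq-p+q≡1 zero = begin
        (q + + 1) * (+ 0 + a)                  ≡⟨ solve (a ∷ b ∷ q ∷ []) ⟩
        q * a + + 0 * (q * a + b) + a          ∎
      partialSum-hseq-p+q≡1 (suc k) = begin
        (q + + 1) * (S (suc k) + h (suc k))
          ≡⟨ *-distribˡ-+ (q + + 1) (S (suc k)) (h (suc k)) ⟩
        (q + + 1) * S (suc k) + (q + + 1) * h (suc k)
          ≡⟨ cong (_+ (q + + 1) * h (suc k)) (partialSum-hseq-p+q≡1 k) ⟩
        q * h k + + k * (q * a + b) + a + (q + + 1) * h (suc k)
          ≡⟨ regroup (h (suc k)) (h k) (+ k) ⟩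
        q * h (suc k) + + k * (q * a + b) + a + (h (suc k) + q * h k)
          ≡⟨ cong (λ e → q * h (suc k) + + k * (q * a + b) + a + e) (hseq-invariant k) ⟩
        q * h (suc k) + + k * (q * a + b) + a + (b + q * a)
          ≡⟨ collect (h (suc k)) (+ k) ⟩
        q * h (suc k) + (+ 1 + + k) * (q * a + b) + a ∎
        where
        regroup : ∀ x y K → q * y + K * (q * a + b) + a + (q + + 1) * x
                          ≡ q * x + K * (q * a + b) + a + (x + q * y)
        regroup x y K = solve (x ∷ y ∷ K ∷ a ∷ b ∷ q ∷ [])
        collect : ∀ x K → q * x + K * (q * a + b) + a + (b + q * a)
                        ≡ q * x + (+ 1 + K) * (q * a + b) + a
        collect x K = solve (x ∷ K ∷ a ∷ b ∷ q ∷ [])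

  module _ (a b : ℤ) where
    private
      h = hseq a b (+ 2) -[1+ 0 ]
      S = partialSum h

    hseq-arithmetic : ∀ k → h k ≡ a + + k * (b - a)
    hseq-arithmetic zero = begin
      a                      ≡⟨ solve (a ∷ b ∷ []) ⟩
      a + + 0 * (b - a)      ∎
    hseq-arithmetic (suc zero) = begin
      b                      ≡⟨ solve (a ∷ b ∷ []) ⟩
      a + + 1 * (b - a)      ∎
    hseq-arithmetic (suc (suc k)) = begin
      + 2 * h (suc k) + -[1+ 0 ] * h k
        ≡⟨ cong₂ (λ x y → + 2 * x + -[1+ 0 ] * y) (hseq-arithmetic (suc k)) (hseq-arithmetic k) ⟩
      + 2 * (a + (+ 1 + + k) * (b - a)) + -[1+ 0 ] * (a + + k * (b - a))
        ≡⟨ step (+ k) ⟩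
      a + (+ 2 + + k) * (b - a) ∎
      where
      step : ∀ K → + 2 * (a + (+ 1 + K) * (b - a)) + -[1+ 0 ] * (a + K * (b - a)) ≡ a + (+ 2 + K) * (b - a)
      step K = solve (K ∷ a ∷ b ∷ [])

    partialSum-arithmetic : ∀ k → + 2 * S (suc k) ≡ + suc k * (h k + a)
    partialSum-arithmetic zero = begin
      + 2 * (+ 0 + a)        ≡⟨ solve (a ∷ []) ⟩
      + 1 * (a + a)          ∎
    partialSum-arithmetic (suc k) = begin
      + 2 * (S (suc k) + h (suc k))
        ≡⟨ *-distribˡ-+ (+ 2) (S (suc k)) (h (suc k)) ⟩
      + 2 * S (suc k) + + 2 * h (suc k)
        ≡⟨ cong (_+ + 2 * h (suc k)) (partialSum-arithmetic k) ⟩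
      + suc k * (h k + a) + + 2 * h (suc k)
        ≡⟨ cong₂ (λ x y → + suc k * (x + a) + + 2 * y) (hseq-arithmetic k) (hseq-arithmetic (suc k)) ⟩
      (+ 1 + + k) * (a + + k * (b - a) + a) + + 2 * (a + (+ 1 + + k) * (b - a))
        ≡⟨ gauss (+ k) ⟩
      (+ 2 + + k) * (a + (+ 1 + + k) * (b - a) + a)
        ≡⟨ cong (λ x → + suc (suc k) * (x + a)) (hseq-arithmetic (suc k)) ⟨
      + suc (suc k) * (h (suc k) + a) ∎
      where
      gauss : ∀ K → (+ 1 + K) * (a + K * (b - a) + a) + + 2 * (a + (+ 1 + K) * (b - a))
                  ≡ (+ 2 + K) * (a + (+ 1 + K) * (b - a) + a)
      gauss K = solve (K ∷ a ∷ b ∷ [])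

open RecurrenceSums
open Circulant using (isSpectralNorm-circulant)
open IntegerToRational using (toℚ-partialSum; toℚ-mono-≤)

theorem3 : (a b p q : ℤ) (n : ℕ) → 1 ℕ.≤ n →
    ((i : ℕ) → i ℕ.< n → + 0 ℤ.≤ hseq a b p q i) →
    IsSpectralNorm n (circulant n (λ i → toℚ (hseq a b p q (toℕ i)))) (toℚ (partialSum (hseq a b p q) n))
    × (p ℤ.+ q ≢ + 1 →
        (p ℤ.+ q ℤ.- + 1) ℤ.* partialSum (hseq a b p q) n
          ≡ hseq a b p q n ℤ.+ q ℤ.* hseq a b p q (n ∸ 1) ℤ.+ (p ℤ.- + 1) ℤ.* a ℤ.- b)
    × (p ℤ.+ q ≡ + 1 → p ≢ + 2 →
        (q ℤ.+ + 1) ℤ.* partialSum (hseq a b p q) n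
          ≡ q ℤ.* hseq a b p q (n ∸ 1) ℤ.+ (+ (n ∸ 1)) ℤ.* (q ℤ.* a ℤ.+ b) ℤ.+ a)
    × (p ≡ + 2 → q ≡ -[1+ 0 ] →
        + 2 ℤ.* partialSum (hseq a b p q) n ≡ (+ n) ℤ.* (hseq a b p q (n ∸ 1) ℤ.+ a))
theorem3 a b p q zero () _
-- The first two identities hold without their side conditions, which only make them determine the sum.
theorem3 a b p q (suc k) _ h≥0 =
  subst (IsSpectralNorm (suc k) (circulant (suc k) v)) (sym (toℚ-partialSum h (suc k)))
    (isSpectralNorm-circulant k v (λ i → toℚ-mono-≤ (h≥0 (toℕ i) (toℕ<n i)))) ,
  (λ _ → partialSum-hseq a b p q k) ,
  (λ p+q≡1 _ → partialSum-hseq-p+q≡1 a b p q p+q≡1 k) ,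
  (λ { refl refl → partialSum-arithmetic a b k })
  where
  h = hseq a b p q
  v = λ i → toℚ (h (toℕ i))
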